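{- There is a bijection $\Phi$ from the set of signatures in $[2n]$ onto the set of Motzkin paths of length $n$ such that for every signature $S$ with associated vector $(s(1),\dots,s(2n))$, \[ \Big(\prod_{i=1}^{2n} s(i)\Big)t^{|S|/2}=\rho(\Phi(S)), \] where the weight $\rho(M)$ of a Motzkin path is the product of its step weights, an up step at height $h\ge0$ having weight $(h+1)(h+2)t$, a level step at height $h\ge0$ having weight $(h+1)^2$, and a down step at height $h\ge1$ having weight $(h+1)h$.
   Context: A signature in $[2n]$ is a set $S\subseteq[2n]$ such that: (i) $S$ has $k$ odd and $k$ even elements for some $k\ge0$; (ii) for each $j\in[n]$, at most one of $2j-1,2j$ lies in $S$; (iii) for each $i\in[2n]$, $S\cap\{1,\dots,i\}$ contains at least as many odd as even elements. For $i\in[2n]$ let $f(i)$ (resp. $g(i)$) be the number of odd (resp. even) elements of $S$ less than $i$; the associated vector is $s(i)=f(i)-g(i)$ if $i\in S$ is even and $s(i)=f(i)-g(i)+1$ otherwise. A Motzkin path of length $n$ is a lattice path from $(0,0)$ to $(n,0)$ staying weakly above the $x$-axis with steps $(1,1)$ (up), $(1,-1)$ (down), $(1,0)$ (level); the height of a step is the $y$-coordinate of its starting point. -}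

module Defs where

open import Data.Bool using (Bool; true; false; _∧_; not; if_then_else_)
open import Data.Nat using (ℕ; zero; suc; _+_; _*_; _∸_; _≤_; _/_)
open import Data.Integer as ℤ using (ℤ; +_)
open import Data.Vec using (Vec; []; _∷_)
open import Data.Fin.Subset using (Subset; ∣_∣)
open import Data.Product using (Σ; _×_)
open import Data.Empty using (⊥)
open import Data.Unit using (⊤)
open import Relation.Nullary using (¬_)
open import Relation.Binary.PropositionalEquality using (_≡_)

-- Signatures.  A subset S ⊆ [2n] = {1,…,2n} is a Subset (2 * n), i.e. a
-- Vec Bool (2 * n) whose entry at position k (0-based) says whether the
-- element k+1 lies in S.

isOdd : ℕ → Bool
isOdd zero          = false
isOdd (suc zero)    = true
isOdd (suc (suc k)) = isOdd k

memAt : ∀ {m} → Vec Bool m → ℕ → Bool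
memAt []      _       = false
memAt (b ∷ v) zero    = b
memAt (b ∷ v) (suc k) = memAt v k

inS : ∀ {m} → Subset m → ℕ → Bool
inS S zero    = false
inS S (suc k) = memAt S k

countBelow : (ℕ → Bool) → ℕ → ℕ
countBelow P zero    = zero
countBelow P (suc i) = countBelow P i + (if P i then 1 else 0)

fS : ∀ {m} → Subset m → ℕ → ℕ
fS S = countBelow (λ k → inS S k ∧ isOdd k)

gS : ∀ {m} → Subset m → ℕ → ℕ
gS S = countBelow (λ k → inS S k ∧ not (isOdd k))

record IsSignature (n : ℕ) (S : Subset (2 * n)) : Set where
  field
    balanced  : fS S (suc (2 * n)) ≡ gS S (suc (2 * n))
    noPair    : ∀ j → 1 ≤ j → j ≤ n →
                ¬ (inS S (2 * j ∸ 1) ≡ true × inS S (2 * j) ≡ true)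
    prefixOK  : ∀ i → 1 ≤ i → i ≤ 2 * n → gS S (suc i) ≤ fS S (suc i)

Signature : ℕ → Set
Signature n = Σ (Subset (2 * n)) (IsSignature n)

sVec : ∀ {m} → Subset m → ℕ → ℤ
sVec S i =
  if inS S i ∧ not (isOdd i)
  then (+ fS S i) ℤ.- (+ gS S i)
  else ((+ fS S i) ℤ.- (+ gS S i)) ℤ.+ ℤ.1ℤ

prodRange : (ℕ → ℤ) → ℕ → ℤ
prodRange h zero    = ℤ.1ℤ
prodRange h (suc m) = prodRange h m ℤ.* h (suc m)

powℤ : ℤ → ℕ → ℤ
powℤ t zero    = ℤ.1ℤ
powℤ t (suc k) = t ℤ.* powℤ t k

sigWeight : (n : ℕ) → Subset (2 * n) → ℤ → ℤ
sigWeight n S t = prodRange (sVec S) (2 * n) ℤ.* powℤ t (∣ S ∣ / 2)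

data Step : Set where
  U L D : Step

ValidFrom : ∀ {m} → ℕ → Vec Step m → Set
ValidFrom zero    []       = ⊤
ValidFrom (suc h) []       = ⊥
ValidFrom h       (U ∷ ss) = ValidFrom (suc h) ss
ValidFrom h       (L ∷ ss) = ValidFrom h ss
ValidFrom zero    (D ∷ ss) = ⊥
ValidFrom (suc h) (D ∷ ss) = ValidFrom h ss

Motzkin : ℕ → Set
Motzkin n = Σ (Vec Step n) (ValidFrom 0)

ρFrom : ∀ {m} → ℤ → ℕ → Vec Step m → ℤ
ρFrom t h       []       = ℤ.1ℤ
ρFrom t h       (U ∷ ss) = (+ ((h + 1) * (h + 2))) ℤ.* t ℤ.* ρFrom t (suc h) ss
ρFrom t h       (L ∷ ss) = (+ ((h + 1) * (h + 1))) ℤ.* ρFrom t h ss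
ρFrom t zero    (D ∷ ss) = ℤ.0ℤ   -- never happens on a Motzkin path
ρFrom t (suc h) (D ∷ ss) = (+ ((suc h + 1) * suc h)) ℤ.* ρFrom t h ss

ρ : ∀ {n} → ℤ → Motzkin n → ℤ
ρ t M = ρFrom t 0 (Data.Product.proj₁ M)

-- Φ reads a signature two elements at a time: step j is up if 2j-1 ∈ S, down if 2j ∈ S and
-- level otherwise, which is well defined and injective by (ii).  Then f(i) - g(i) is the height
-- of the path before position i, so (i) and (iii) say exactly that the path ends at height 0
-- and never goes below it.  A step starting at height h contributes s(2j-1) = h + 1 and
-- s(2j) = h + 2, h + 1 or h for an up, level or down step, which are the step weights of ρ,
-- while |S|/2 is the number of up steps.

module Submission where

open import Defs
open import Data.Nat using (ℕ)
open import Data.Integer using (ℤ)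
open import Data.Product using (Σ; _×_; proj₁)
open import Relation.Binary.PropositionalEquality using (_≡_)

open import Data.Bool using (Bool; true; false; _∧_; not; if_then_else_)
open import Data.Nat using (zero; suc; _+_; _*_; _∸_; _/_; _≤_; _<_; z≤n; s≤s)
import Data.Nat.Properties as ℕ
open import Data.Nat.DivMod using (m*n/n≡m)
open import Data.Integer as ℤ using (+_; 1ℤ)
import Data.Integer.Properties as ℤ
open import Data.Integer.Tactic.RingSolver using (solve-∀)
open import Data.Vec using (Vec; []; _∷_)
open import Data.Fin.Subset using (Subset; ∣_∣)
open import Data.Product using (_,_; proj₂)
open import Data.Product.Function.NonDependent.Propositional using (_×-⇔_)
open import Data.Empty using (⊥-elim)
open import Data.Unit using (tt)
open import Function.Bundles using (_⇔_; mk⇔; Equivalence)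
open import Function.Construct.Composition using (_⇔-∘_)
open import Relation.Nullary using (¬_)
open import Relation.Binary.PropositionalEquality
  using (refl; sym; trans; cong; cong₂; subst; subst₂; module ≡-Reasoning)
open import Relation.Binary.PropositionalEquality.Properties
  using (subst-subst-sym; subst-sym-subst)

open Equivalence using (to; from)

-- 2 * suc n does not reduce to suc (suc (2 * n)), so words of even length are built over double n.
double : ℕ → ℕ
double zero    = zero
double (suc n) = suc (suc (double n))

2*n≡double : ∀ n → 2 * n ≡ double n
2*n≡double zero    = refl
2*n≡double (suc n) = cong suc (trans (ℕ.+-suc n (n + 0)) (cong suc (2*n≡double n)))

subst-invariant : ∀ {ℓ} {X : Set ℓ} (F : ∀ {m} → Vec Bool m → X)
                  {m m′} (e : m ≡ m′) (v : Vec Bool m) → F (subst (Vec Bool) e v) ≡ F v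
subst-invariant F refl v = refl

bit : Bool → ℕ
bit b = if b then 1 else 0

fS-∷∷ : ∀ {m} a b (v : Vec Bool m) i → fS (a ∷ b ∷ v) (3 + i) ≡ bit a + fS v (suc i)
fS-∷∷ false false v zero = refl
fS-∷∷ false true  v zero = refl
fS-∷∷ true  false v zero = refl
fS-∷∷ true  true  v zero = refl
fS-∷∷ a b v (suc i) =
  trans (cong (_+ bit (inS v (suc i) ∧ isOdd (suc i))) (fS-∷∷ a b v i))
        (ℕ.+-assoc (bit a) (fS v (suc i)) _)

gS-∷∷ : ∀ {m} a b (v : Vec Bool m) i → gS (a ∷ b ∷ v) (3 + i) ≡ bit b + gS v (suc i)
gS-∷∷ false false v zero = refl
gS-∷∷ false true  v zero = refl
gS-∷∷ true  false v zero = refl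
gS-∷∷ true  true  v zero = refl
gS-∷∷ a b v (suc i) =
  trans (cong (_+ bit (inS v (suc i) ∧ not (isOdd (suc i)))) (gS-∷∷ a b v i))
        (ℕ.+-assoc (bit b) (gS v (suc i)) _)

gS-∷∷-2 : ∀ {m} a b (v : Vec Bool m) → gS (a ∷ b ∷ v) 2 ≡ 0
gS-∷∷-2 false b v = refl
gS-∷∷-2 true  b v = refl

excess : ∀ {m} → Vec Bool m → ℕ → ℤ
excess v i = + fS v i ℤ.- + gS v i

excess-∷∷ : ∀ {m} a b (v : Vec Bool m) i →
            excess (a ∷ b ∷ v) (3 + i) ≡ (+ bit a ℤ.- + bit b) ℤ.+ excess v (suc i)
excess-∷∷ a b v i = begin
  + fS (a ∷ b ∷ v) (3 + i) ℤ.- + gS (a ∷ b ∷ v) (3 + i)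
    ≡⟨ cong₂ (λ f g → + f ℤ.- + g) (fS-∷∷ a b v i) (gS-∷∷ a b v i) ⟩
  + (bit a + fS v (suc i)) ℤ.- + (bit b + gS v (suc i))
    ≡⟨ cong₂ ℤ._-_ (ℤ.pos-+ (bit a) _) (ℤ.pos-+ (bit b) _) ⟩
  (+ bit a ℤ.+ + fS v (suc i)) ℤ.- (+ bit b ℤ.+ + gS v (suc i))
    ≡⟨ regroup (+ bit a) (+ fS v (suc i)) (+ bit b) (+ gS v (suc i)) ⟩
  (+ bit a ℤ.- + bit b) ℤ.+ excess v (suc i) ∎
  where
  open ≡-Reasoning
  regroup : ∀ a f b g → (a ℤ.+ f) ℤ.- (b ℤ.+ g) ≡ (a ℤ.- b) ℤ.+ (f ℤ.- g)
  regroup = solve-∀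

sVec-∷∷ : ∀ {m} a b (v : Vec Bool m) i →
          sVec (a ∷ b ∷ v) (3 + i) ≡ (+ bit a ℤ.- + bit b) ℤ.+ sVec v (suc i)
sVec-∷∷ a b v i =
  trans (cong (λ E → if c then E else E ℤ.+ 1ℤ) (excess-∷∷ a b v i))
        (if-+ c (+ bit a ℤ.- + bit b) (excess v (suc i)))
  where
  c : Bool
  c = inS v (suc i) ∧ not (isOdd (suc i))
  if-+ : ∀ c d E → (if c then d ℤ.+ E else (d ℤ.+ E) ℤ.+ 1ℤ)
                   ≡ d ℤ.+ (if c then E else E ℤ.+ 1ℤ)
  if-+ true  d E = refl
  if-+ false d E = ℤ.+-assoc d E 1ℤ

prodRange-cong : ∀ {f g : ℕ → ℤ} → (∀ i → f (suc i) ≡ g (suc i)) →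
                 ∀ k → prodRange f k ≡ prodRange g k
prodRange-cong f≗g zero    = refl
prodRange-cong f≗g (suc k) = cong₂ ℤ._*_ (prodRange-cong f≗g k) (f≗g k)

prodRange-sucˡ : ∀ f k → prodRange f (suc k) ≡ f 1 ℤ.* prodRange (λ i → f (suc i)) k
prodRange-sucˡ f zero    = ℤ.*-comm 1ℤ (f 1)
prodRange-sucˡ f (suc k) =
  trans (cong (ℤ._* f (2 + k)) (prodRange-sucˡ f k)) (ℤ.*-assoc (f 1) _ (f (2 + k)))

-- A suffix of a path starts at some height H, which shifts each factor s(i) by H.
shiftedProduct : ∀ {m} → ℤ → Vec Bool m → ℤ
shiftedProduct {m} H v = prodRange (λ i → H ℤ.+ sVec v i) m

shiftedProduct-∷∷ : ∀ {m} H a b (v : Vec Bool m) →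
  shiftedProduct H (a ∷ b ∷ v) ≡
  ((H ℤ.+ sVec (a ∷ b ∷ v) 1) ℤ.* (H ℤ.+ sVec (a ∷ b ∷ v) 2))
    ℤ.* shiftedProduct (H ℤ.+ (+ bit a ℤ.- + bit b)) v
shiftedProduct-∷∷ {m} H a b v = begin
  prodRange F (2 + m)
    ≡⟨ prodRange-sucˡ F (suc m) ⟩
  F 1 ℤ.* prodRange (λ i → F (suc i)) (suc m)
    ≡⟨ cong (F 1 ℤ.*_) (prodRange-sucˡ (λ i → F (suc i)) m) ⟩
  F 1 ℤ.* (F 2 ℤ.* prodRange (λ i → F (2 + i)) m)
    ≡⟨ ℤ.*-assoc (F 1) (F 2) _ ⟨
  (F 1 ℤ.* F 2) ℤ.* prodRange (λ i → F (2 + i)) m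
    ≡⟨ cong ((F 1 ℤ.* F 2) ℤ.*_) (prodRange-cong shift m) ⟩
  (F 1 ℤ.* F 2) ℤ.* shiftedProduct (H ℤ.+ d) v ∎
  where
  open ≡-Reasoning
  F : ℕ → ℤ
  F i = H ℤ.+ sVec (a ∷ b ∷ v) i
  d : ℤ
  d = + bit a ℤ.- + bit b
  shift : ∀ i → F (3 + i) ≡ (H ℤ.+ d) ℤ.+ sVec v (suc i)
  shift i = trans (cong (ℤ._+_ H) (sVec-∷∷ a b v i)) (sym (ℤ.+-assoc H d (sVec v (suc i))))

isUp : Step → Bool
isUp U = true
isUp L = false
isUp D = false

isDown : Step → Bool
isDown U = false
isDown L = false
isDown D = true

encode : ∀ {m} → Vec Step m → Vec Bool (double m)
encode []      = []
encode (s ∷ M) = isUp s ∷ isDown s ∷ encode M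

toStep : Bool → Bool → Step
toStep true  _     = U
toStep false true  = D
toStep false false = L

decode : ∀ {m} → Vec Bool (double m) → Vec Step m
decode {zero}  []          = []
decode {suc m} (a ∷ b ∷ v) = toStep a b ∷ decode v

decode-encode : ∀ {m} (M : Vec Step m) → decode (encode M) ≡ M
decode-encode []      = refl
decode-encode (U ∷ M) = cong (U ∷_) (decode-encode M)
decode-encode (L ∷ M) = cong (L ∷_) (decode-encode M)
decode-encode (D ∷ M) = cong (D ∷_) (decode-encode M)

PairFree : ∀ {m} → ℕ → Vec Bool m → Set
PairFree n v =
  ∀ k → k < n → ¬ (memAt v (double k) ≡ true × memAt v (suc (double k)) ≡ true)

encode-pairFree : ∀ {m} (M : Vec Step m) → PairFree m (encode M)
encode-pairFree (U ∷ M) zero    _         (_ , ())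
encode-pairFree (L ∷ M) zero    _         (() , _)
encode-pairFree (D ∷ M) zero    _         (() , _)
encode-pairFree (s ∷ M) (suc k) (s≤s k<m) = encode-pairFree M k k<m

toStep-bits : ∀ a b → ¬ (a ≡ true × b ≡ true) →
              isUp (toStep a b) ≡ a × isDown (toStep a b) ≡ b
toStep-bits true  true  ¬both = ⊥-elim (¬both (refl , refl))
toStep-bits true  false _     = refl , refl
toStep-bits false true  _     = refl , refl
toStep-bits false false _     = refl , refl

encode-decode : ∀ {m} (v : Vec Bool (double m)) → PairFree m v → encode (decode v) ≡ v
encode-decode {zero}  []          _  = refl
encode-decode {suc m} (a ∷ b ∷ v) pf with toStep-bits a b (pf 0 (s≤s z≤n))
... | up≡a , down≡b =
  cong₂ _∷_ up≡a (cong₂ _∷_ down≡b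
    (encode-decode v (λ k k<m → pf (suc k) (s≤s k<m))))

ups : ∀ {m} → Vec Step m → ℕ
ups []      = 0
ups (U ∷ M) = suc (ups M)
ups (L ∷ M) = ups M
ups (D ∷ M) = ups M

downs : ∀ {m} → Vec Step m → ℕ
downs []      = 0
downs (U ∷ M) = downs M
downs (L ∷ M) = downs M
downs (D ∷ M) = suc (downs M)

∣encode∣ : ∀ {m} (M : Vec Step m) → ∣ encode M ∣ ≡ ups M + downs M
∣encode∣ []      = refl
∣encode∣ (U ∷ M) = cong suc (∣encode∣ M)
∣encode∣ (L ∷ M) = ∣encode∣ M
∣encode∣ (D ∷ M) = trans (cong suc (∣encode∣ M)) (sym (ℕ.+-suc (ups M) (downs M)))

validFrom-ups : ∀ {m} (M : Vec Step m) h → ValidFrom h M → h + ups M ≡ downs M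
validFrom-ups []      zero    _     = refl
validFrom-ups (U ∷ M) zero    valid = validFrom-ups M 1 valid
validFrom-ups (U ∷ M) (suc h) valid =
  trans (ℕ.+-suc (suc h) (ups M)) (validFrom-ups M (2 + h) valid)
validFrom-ups (L ∷ M) zero    valid = validFrom-ups M 0 valid
validFrom-ups (L ∷ M) (suc h) valid = validFrom-ups M (suc h) valid
validFrom-ups (D ∷ M) (suc h) valid = cong suc (validFrom-ups M h valid)

-- Read v as a walk starting at height h: odd members step up, even members step down.
PrefixBounded : ∀ {m} → ℕ → Vec Bool m → Set
PrefixBounded {m} h v = ∀ i → i ≤ m → gS v (suc i) ≤ h + fS v (suc i)

Balanced : ∀ {m} → ℕ → Vec Bool m → Set
Balanced {m} h v = h + fS v (suc m) ≡ gS v (suc m)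

Ballot : ∀ {m} → ℕ → Vec Bool m → Set
Ballot h v = PrefixBounded h v × Balanced h v

module _ {h h′ a b : ℕ} (h+a≡b+h′ : h + a ≡ b + h′) where

  private
    regroup : ∀ f → h + (a + f) ≡ b + (h′ + f)
    regroup f =
      trans (sym (ℕ.+-assoc h a f)) (trans (cong (_+ f) h+a≡b+h′) (ℕ.+-assoc b h′ f))

  shift-≤ : ∀ f g → g ≤ h′ + f ⇔ b + g ≤ h + (a + f)
  shift-≤ f g = mk⇔
    (λ le → subst (b + g ≤_) (sym (regroup f)) (ℕ.+-monoʳ-≤ b le))
    (λ le → ℕ.+-cancelˡ-≤ b g (h′ + f) (subst (b + g ≤_) (regroup f) le))

  shift-≡ : ∀ f g → h′ + f ≡ g ⇔ h + (a + f) ≡ b + g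
  shift-≡ f g = mk⇔
    (λ eq → trans (regroup f) (cong (_+_ b) eq))
    (λ eq → ℕ.+-cancelˡ-≡ b (h′ + f) g (trans (sym (regroup f)) eq))

module _ {m h h′} (a b : Bool) (v : Vec Bool m) (step : h + bit a ≡ bit b + h′) where

  prefixBounded-∷∷ : PrefixBounded h′ v ⇔ PrefixBounded h (a ∷ b ∷ v)
  prefixBounded-∷∷ = mk⇔ extend restrict
    where
    shifted : ∀ j → gS v (suc j) ≤ h′ + fS v (suc j)
                  ⇔ gS (a ∷ b ∷ v) (3 + j) ≤ h + fS (a ∷ b ∷ v) (3 + j)
    shifted j = subst₂ (λ G F → gS v (suc j) ≤ h′ + fS v (suc j) ⇔ G ≤ h + F)
                       (sym (gS-∷∷ a b v j)) (sym (fS-∷∷ a b v j))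
                       (shift-≤ {a = bit a} {b = bit b} step (fS v (suc j)) (gS v (suc j)))
    extend : PrefixBounded h′ v → PrefixBounded h (a ∷ b ∷ v)
    extend bounded zero          _               = z≤n
    extend bounded (suc zero)    _               =
      subst (_≤ h + fS (a ∷ b ∷ v) 2) (sym (gS-∷∷-2 a b v)) z≤n
    extend bounded (suc (suc j)) (s≤s (s≤s j≤m)) = shifted j .to (bounded j j≤m)
    restrict : PrefixBounded h (a ∷ b ∷ v) → PrefixBounded h′ v
    restrict bounded j j≤m = shifted j .from (bounded (2 + j) (s≤s (s≤s j≤m)))

  balanced-∷∷ : Balanced h′ v ⇔ Balanced h (a ∷ b ∷ v)
  balanced-∷∷ = subst₂ (λ F G → Balanced h′ v ⇔ h + F ≡ G)
                       (sym (fS-∷∷ a b v m)) (sym (gS-∷∷ a b v m))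
                       (shift-≡ {a = bit a} {b = bit b} step (fS v (suc m)) (gS v (suc m)))

  ballot-∷∷ : Ballot h′ v ⇔ Ballot h (a ∷ b ∷ v)
  ballot-∷∷ = prefixBounded-∷∷ ×-⇔ balanced-∷∷

-- ValidFrom splits on the height before the step, hence the two clauses for U and L.
valid⇔ballot : ∀ {m} (M : Vec Step m) h → ValidFrom h M ⇔ Ballot h (encode M)
valid⇔ballot []      zero    = mk⇔ (λ _ → (λ { zero _ → z≤n }) , refl) (λ _ → tt)
valid⇔ballot []      (suc h) = mk⇔ (λ ()) (λ { (_ , ()) })
valid⇔ballot (U ∷ M) zero    =
  ballot-∷∷ {h = 0} {h′ = 1} true false (encode M) refl
    ⇔-∘ valid⇔ballot M 1
valid⇔ballot (U ∷ M) (suc h) =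
  ballot-∷∷ {h = suc h} {h′ = 2 + h} true false (encode M) (ℕ.+-comm (suc h) 1)
    ⇔-∘ valid⇔ballot M (2 + h)
valid⇔ballot (L ∷ M) zero    =
  ballot-∷∷ {h = 0} {h′ = 0} false false (encode M) refl
    ⇔-∘ valid⇔ballot M 0
valid⇔ballot (L ∷ M) (suc h) =
  ballot-∷∷ {h = suc h} {h′ = suc h} false false (encode M) (ℕ.+-identityʳ (suc h))
    ⇔-∘ valid⇔ballot M (suc h)
valid⇔ballot (D ∷ M) zero    =
  mk⇔ (λ ()) (λ (bounded , _) → ℕ.1+n≰n (bounded 2 (s≤s (s≤s z≤n))))
valid⇔ballot (D ∷ M) (suc h) =
  ballot-∷∷ {h = suc h} {h′ = h} false true (encode M) (ℕ.+-identityʳ (suc h))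
    ⇔-∘ valid⇔ballot M h

shiftedProduct-weight : ∀ {m} (M : Vec Step m) h t →
                        shiftedProduct (+ h) (encode M) ℤ.* powℤ t (ups M) ≡ ρFrom t h M
shiftedProduct-weight []      h       t = refl
shiftedProduct-weight (U ∷ M) h       t = begin
  shiftedProduct (+ h) (encode (U ∷ M)) ℤ.* (t ℤ.* T)
    ≡⟨ cong (ℤ._* (t ℤ.* T)) (shiftedProduct-∷∷ (+ h) true false (encode M)) ⟩
  ((+ (h + 1) ℤ.* + (h + 2)) ℤ.* shiftedProduct (+ (h + 1)) (encode M)) ℤ.* (t ℤ.* T)
    ≡⟨ interchange (+ (h + 1) ℤ.* + (h + 2)) (shiftedProduct (+ (h + 1)) (encode M)) t T ⟩
  ((+ (h + 1) ℤ.* + (h + 2)) ℤ.* t) ℤ.* rest (h + 1)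
    ≡⟨ cong₂ (λ c k → (c ℤ.* t) ℤ.* rest k) (sym (ℤ.pos-* (h + 1) (h + 2))) (ℕ.+-comm h 1) ⟩
  (+ ((h + 1) * (h + 2)) ℤ.* t) ℤ.* rest (suc h)
    ≡⟨ cong (ℤ._*_ (+ ((h + 1) * (h + 2)) ℤ.* t)) (shiftedProduct-weight M (suc h) t) ⟩
  ρFrom t h (U ∷ M) ∎
  where
  open ≡-Reasoning
  T : ℤ
  T = powℤ t (ups M)
  rest : ℕ → ℤ
  rest k = shiftedProduct (+ k) (encode M) ℤ.* T
  interchange : ∀ a p t q → (a ℤ.* p) ℤ.* (t ℤ.* q) ≡ (a ℤ.* t) ℤ.* (p ℤ.* q)
  interchange = solve-∀
shiftedProduct-weight (L ∷ M) h       t = begin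
  shiftedProduct (+ h) (encode (L ∷ M)) ℤ.* T
    ≡⟨ cong (ℤ._* T) (shiftedProduct-∷∷ (+ h) false false (encode M)) ⟩
  ((+ (h + 1) ℤ.* + (h + 1)) ℤ.* shiftedProduct (+ (h + 0)) (encode M)) ℤ.* T
    ≡⟨ ℤ.*-assoc (+ (h + 1) ℤ.* + (h + 1)) (shiftedProduct (+ (h + 0)) (encode M)) T ⟩
  (+ (h + 1) ℤ.* + (h + 1)) ℤ.* rest (h + 0)
    ≡⟨ cong₂ (λ c k → c ℤ.* rest k) (sym (ℤ.pos-* (h + 1) (h + 1))) (ℕ.+-identityʳ h) ⟩
  + ((h + 1) * (h + 1)) ℤ.* rest h
    ≡⟨ cong (ℤ._*_ (+ ((h + 1) * (h + 1)))) (shiftedProduct-weight M h t) ⟩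
  ρFrom t h (L ∷ M) ∎
  where
  open ≡-Reasoning
  T : ℤ
  T = powℤ t (ups M)
  rest : ℕ → ℤ
  rest k = shiftedProduct (+ k) (encode M) ℤ.* T
shiftedProduct-weight (D ∷ M) zero    t =
  cong (ℤ._* powℤ t (ups M)) (shiftedProduct-∷∷ (+ 0) false true (encode M))
shiftedProduct-weight (D ∷ M) (suc h) t = begin
  shiftedProduct (+ suc h) (encode (D ∷ M)) ℤ.* T
    ≡⟨ cong (ℤ._* T) (shiftedProduct-∷∷ (+ suc h) false true (encode M)) ⟩
  ((+ (suc h + 1) ℤ.* + (suc h + 0)) ℤ.* shiftedProduct (+ h) (encode M)) ℤ.* T
    ≡⟨ ℤ.*-assoc (+ (suc h + 1) ℤ.* + (suc h + 0)) (shiftedProduct (+ h) (encode M)) T ⟩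
  (+ (suc h + 1) ℤ.* + (suc h + 0)) ℤ.* rest
    ≡⟨ cong (ℤ._* rest) (sym (ℤ.pos-* (suc h + 1) (suc h + 0))) ⟩
  + ((suc h + 1) * (suc h + 0)) ℤ.* rest
    ≡⟨ cong₂ (λ k r → + ((suc h + 1) * k) ℤ.* r) (ℕ.+-identityʳ (suc h))
             (shiftedProduct-weight M h t) ⟩
  ρFrom t (suc h) (D ∷ M) ∎
  where
  open ≡-Reasoning
  T : ℤ
  T = powℤ t (ups M)
  rest : ℤ
  rest = shiftedProduct (+ h) (encode M) ℤ.* T

wordWeight : ∀ {m} → Vec Bool m → ℤ → ℤ
wordWeight {m} v t = prodRange (sVec v) m ℤ.* powℤ t (∣ v ∣ / 2)

weight-encode : ∀ {m} (M : Vec Step m) → ValidFrom 0 M →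
                ∀ t → wordWeight (encode M) t ≡ ρFrom t 0 M
weight-encode {m} M valid t = begin
  prodRange (sVec (encode M)) (double m) ℤ.* powℤ t (∣ encode M ∣ / 2)
    ≡⟨ cong₂ ℤ._*_ (prodRange-cong (λ i → sym (ℤ.+-identityˡ (sVec (encode M) (suc i))))
                                   (double m))
                   (cong (powℤ t) half-size) ⟩
  shiftedProduct (+ 0) (encode M) ℤ.* powℤ t (ups M)
    ≡⟨ shiftedProduct-weight M 0 t ⟩
  ρFrom t 0 M ∎
  where
  open ≡-Reasoning
  half-size : ∣ encode M ∣ / 2 ≡ ups M
  half-size = begin
    ∣ encode M ∣ / 2
      ≡⟨ cong (_/ 2) (∣encode∣ M) ⟩
    (ups M + downs M) / 2
      ≡⟨ cong (λ d → (ups M + d) / 2) (sym (validFrom-ups M 0 valid)) ⟩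
    (ups M + ups M) / 2
      ≡⟨ cong (λ u → (ups M + u) / 2) (sym (ℕ.+-identityʳ (ups M))) ⟩
    2 * ups M / 2
      ≡⟨ cong (_/ 2) (ℕ.*-comm 2 (ups M)) ⟩
    ups M * 2 / 2
      ≡⟨ m*n/n≡m (ups M) 2 ⟩
    ups M ∎

IsSignatureWord : ∀ {m} → ℕ → Vec Bool m → Set
IsSignatureWord n v = Ballot 0 v × PairFree n v

pairFree⇔noPair : ∀ {m} n (v : Vec Bool m) →
  PairFree n v ⇔
  (∀ j → 1 ≤ j → j ≤ n → ¬ (inS v (2 * j ∸ 1) ≡ true × inS v (2 * j) ≡ true))
pairFree⇔noPair n v = mk⇔
  (λ { pf (suc k) _ k<n → subst NoPairAt (sym (2*n≡double (suc k))) (pf k k<n) })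
  (λ np k k<n → subst NoPairAt (2*n≡double (suc k)) (np (suc k) (s≤s z≤n) k<n))
  where
  NoPairAt : ℕ → Set
  NoPairAt x = ¬ (inS v (x ∸ 1) ≡ true × inS v x ≡ true)

isSignature⇔ : ∀ n (S : Subset (2 * n)) → IsSignature n S ⇔ IsSignatureWord n S
isSignature⇔ n S = mk⇔
  (λ σ → (prefixBounded σ , IsSignature.balanced σ)
       , pairFree⇔noPair n S .from (IsSignature.noPair σ))
  (λ ((bounded , bal) , pf) → record
    { balanced = bal
    ; noPair   = pairFree⇔noPair n S .to pf
    ; prefixOK = λ i _ i≤2n → bounded i i≤2n
    })
  where
  prefixBounded : IsSignature n S → PrefixBounded 0 S
  prefixBounded σ zero    _      = z≤n
  prefixBounded σ (suc i) i<2n = IsSignature.prefixOK σ (suc i) (s≤s z≤n) i<2n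

toDouble : ∀ n → Subset (2 * n) → Vec Bool (double n)
toDouble n = subst (Vec Bool) (2*n≡double n)

encodeSig : ∀ {n} → Vec Step n → Subset (2 * n)
encodeSig {n} M = subst (Vec Bool) (sym (2*n≡double n)) (encode M)

decodeSig : ∀ n → Subset (2 * n) → Vec Step n
decodeSig n S = decode (toDouble n S)

isSignature⇔toDouble : ∀ n (S : Subset (2 * n)) →
                       IsSignature n S ⇔ IsSignatureWord n (toDouble n S)
isSignature⇔toDouble n S =
  subst (IsSignature n S ⇔_) (sym (subst-invariant (IsSignatureWord n) (2*n≡double n) S))
        (isSignature⇔ n S)

toDouble-encodeSig : ∀ {n} (M : Vec Step n) → toDouble n (encodeSig M) ≡ encode M
toDouble-encodeSig {n} M = subst-subst-sym (2*n≡double n)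

encodeSig-decodeSig : ∀ {n} {S : Subset (2 * n)} → IsSignature n S →
                      encodeSig (decodeSig n S) ≡ S
encodeSig-decodeSig {n} {S} σ =
  trans (cong (subst (Vec Bool) (sym (2*n≡double n)))
              (encode-decode (toDouble n S) (proj₂ (isSignature⇔toDouble n S .to σ))))
        (subst-sym-subst (2*n≡double n))

decodeSig-encodeSig : ∀ {n} (M : Vec Step n) → decodeSig n (encodeSig M) ≡ M
decodeSig-encodeSig {n} M = trans (cong decode (toDouble-encodeSig M)) (decode-encode M)

decodeSig-valid : ∀ {n} {S : Subset (2 * n)} → IsSignature n S → ValidFrom 0 (decodeSig n S)
decodeSig-valid {n} {S} σ with isSignature⇔toDouble n S .to σ
... | ballot , pf =
  valid⇔ballot (decodeSig n S) 0 .from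
    (subst (Ballot 0) (sym (encode-decode (toDouble n S) pf)) ballot)

encodeSig-isSignature : ∀ {n} {M : Vec Step n} → ValidFrom 0 M → IsSignature n (encodeSig M)
encodeSig-isSignature {n} {M} valid =
  isSignature⇔toDouble n (encodeSig M) .from
    (subst (IsSignatureWord n) (sym (toDouble-encodeSig M))
           (valid⇔ballot M 0 .to valid , encode-pairFree M))

weight-encodeSig : ∀ {n} (M : Vec Step n) → ValidFrom 0 M →
                   ∀ t → sigWeight n (encodeSig M) t ≡ ρFrom t 0 M
weight-encodeSig {n} M valid t =
  trans (subst-invariant (λ v → wordWeight v t) (sym (2*n≡double n)) (encode M))
        (weight-encode M valid t)

lemma2p9 : (n : ℕ) →
    Σ (Signature n → Motzkin n) λ Φ →
      ((S S′ : Signature n) → proj₁ (Φ S) ≡ proj₁ (Φ S′) → proj₁ S ≡ proj₁ S′)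
      × ((M : Motzkin n) → Σ (Signature n) λ S → proj₁ (Φ S) ≡ proj₁ M)
      × ((S : Signature n) (t : ℤ) → sigWeight n (proj₁ S) t ≡ ρ t (Φ S))
lemma2p9 n = Φ , injective , surjective , weight-preserved
  where
  Φ : Signature n → Motzkin n
  Φ (S , σ) = decodeSig n S , decodeSig-valid σ

  injective : (S S′ : Signature n) → proj₁ (Φ S) ≡ proj₁ (Φ S′) → proj₁ S ≡ proj₁ S′
  injective (S , σ) (S′ , σ′) same =
    trans (sym (encodeSig-decodeSig σ)) (trans (cong encodeSig same) (encodeSig-decodeSig σ′))

  surjective : (M : Motzkin n) → Σ (Signature n) λ S → proj₁ (Φ S) ≡ proj₁ M
  surjective (M , valid) = (encodeSig M , encodeSig-isSignature valid) , decodeSig-encodeSig M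

  weight-preserved : (S : Signature n) (t : ℤ) → sigWeight n (proj₁ S) t ≡ ρ t (Φ S)
  weight-preserved (S , σ) t =
    trans (cong (λ S → sigWeight n S t) (sym (encodeSig-decodeSig σ)))
          (weight-encodeSig (decodeSig n S) (decodeSig-valid σ) t)
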